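{- Let $G$ be a connected interval graph with interval ordering $(v_1,\dots,v_n)$, and run the following procedure: start with $S=\emptyset$ and $V_T=\{v_1\}$; while $V_T\neq V(G)$, let $t_1=\min\{i: v_i\notin V_T\}$, $t_2=\max\{i: v_i\in V_T\}$, $t=\min\{t_1,t_2\}$, $s=\max\{i: v_i\in N[v_t]\}$, then set $S\leftarrow S\cup\{v_s\}$ and $V_T\leftarrow V_T\cup N[v_s]$; finally return $S$. Then the returned set $S$ is a vertex cover of some spanning tree of $G$, and $|S|$ equals the minimum, over all spanning trees $T$ of $G$, of the minimum size of a vertex cover of $T$.
   Context: An interval ordering of an $n$-vertex graph $G$ is an ordering $(v_1,\dots,v_n)$ of its vertices such that for all $a<b<c$, if $v_av_c\in E(G)$ then $v_bv_c\in E(G)$; an interval graph is a graph having an interval ordering. $N[v]$ denotes the closed neighborhood of $v$ (its neighbors together with $v$). A vertex cover of a tree $T$ is a set of vertices containing at least one endpoint of every edge of $T$. -}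

module Defs where

open import Data.Nat using (ℕ; suc)
open import Data.Bool using (Bool; true; false; _∨_)
open import Data.Fin using (Fin; zero; _≤_; _<_; _≟_)
open import Data.Fin.Subset using (Subset; _∈_; _∉_; _∪_; ⁅_⁆; ⊤; ∣_∣)
open import Data.Vec using (tabulate)
open import Data.List using (List; _∷_; []; length; last)
open import Data.List.Relation.Unary.Unique.Propositional using (Unique)
open import Data.List.Relation.Unary.Linked using (Linked)
open import Data.Maybe using (just)
open import Data.Product using (Σ; _×_; ∃; ∃-syntax; _,_)
open import Data.Sum using (_⊎_)
open import Relation.Nullary using (¬_)
open import Relation.Nullary.Decidable using (⌊_⌋)
open import Relation.Binary.PropositionalEquality using (_≡_; _≢_)

record Graph (n : ℕ) : Set where
  field
    adj    : Fin n → Fin n → Bool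
    sym    : ∀ u v → adj u v ≡ adj v u
    irrefl : ∀ v → adj v v ≡ false

open Graph public

Edge : ∀ {n} → Graph n → Fin n → Fin n → Set
Edge G u v = adj G u v ≡ true

-- The natural order of Fin n, (v_0 , … , v_{n-1}), is an interval ordering:
-- for all a < b < c, if v_a v_c ∈ E(G) then v_b v_c ∈ E(G).
IsIntervalOrdering : ∀ {n} → Graph n → Set
IsIntervalOrdering {n} G =
  ∀ (a b c : Fin n) → a < b → b < c → Edge G a c → Edge G b c

data Reach {n} (G : Graph n) : Fin n → Fin n → Set where
  here : ∀ {u} → Reach G u u
  step : ∀ {u v w} → Edge G u v → Reach G v w → Reach G u w

Connected : ∀ {n} → Graph n → Set
Connected {n} G = ∀ (u v : Fin n) → Reach G u v

IsCycle : ∀ {n} → Graph n → List (Fin n) → Set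
IsCycle G [] = Data.Empty.⊥
  where import Data.Empty
IsCycle G (x ∷ xs) =
  (3 Data.Nat.≤ length (x ∷ xs)) × Unique (x ∷ xs) × Linked (Edge G) (x ∷ xs)
  × Σ (Fin _) (λ y → (last (x ∷ xs) ≡ just y) × Edge G y x)
  where import Data.Nat

Acyclic : ∀ {n} → Graph n → Set
Acyclic {n} G = ∀ (c : List (Fin n)) → ¬ IsCycle G c

IsTree : ∀ {n} → Graph n → Set
IsTree G = Connected G × Acyclic G

IsSpanningTree : ∀ {n} → Graph n → Graph n → Set
IsSpanningTree {n} G T = (∀ (u v : Fin n) → Edge T u v → Edge G u v) × IsTree T

IsVertexCover : ∀ {n} → Graph n → Subset n → Set
IsVertexCover {n} T C = ∀ (u v : Fin n) → Edge T u v → (u ∈ C) ⊎ (v ∈ C)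

N[_] : ∀ {n} → Graph n → Fin n → Subset n
N[_] G v = tabulate (λ u → adj G v u ∨ ⌊ u ≟ v ⌋)

IsLeast : ∀ {n} → (Fin n → Set) → Fin n → Set
IsLeast {n} P i = P i × (∀ (j : Fin n) → P j → i ≤ j)

IsGreatest : ∀ {n} → (Fin n → Set) → Fin n → Set
IsGreatest {n} P i = P i × (∀ (j : Fin n) → P j → j ≤ i)

IsMin₂ : ∀ {n} → Fin n → Fin n → Fin n → Set
IsMin₂ t₁ t₂ t = (t₁ ≤ t₂ × t ≡ t₁) ⊎ (t₂ < t₁ × t ≡ t₂)

-- Big-step semantics of the while-loop of the procedure:
-- Runs G S V_T R  means: started in state (S , V_T), the loop terminates
-- and the procedure returns R.
data Runs {n} (G : Graph n) : Subset n → Subset n → Subset n → Set where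
  done : ∀ {S VT} → VT ≡ ⊤ → Runs G S VT S
  loop : ∀ {S VT R} (t₁ t₂ t s : Fin n) →
         VT ≢ ⊤ →
         IsLeast (λ i → i ∉ VT) t₁ →
         IsGreatest (λ i → i ∈ VT) t₂ →
         IsMin₂ t₁ t₂ t →
         IsGreatest (λ i → i ∈ N[ G ] t) s →
         Runs G (S ∪ ⁅ s ⁆) (VT ∪ N[ G ] s) R →
         Runs G S VT R

{-# OPTIONS --safe #-}
module Submission where

-- Let lo be one more than the index of the previously chosen v_s (initially 0). The loop
-- keeps V_T = {v₀} ∪ N[v₀, …, v_{lo-1}], and each round has lo ≤ t₁ ≤ s.
-- Lower bound: every spanning tree has an edge leaving V_T with both ends of index ≤ s
-- (if t = t₁, any tree edge at v_{t₁}; if t = t₂ < t₁, the edge where the tree path from v₀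
-- to v_{t₁} leaves V_T, which lands in N[v_t] by the interval property). Either end of it
-- has index ≥ lo, so every vertex cover meets each of the disjoint windows {v_lo, …, v_s}.
-- Upper bound: hanging the new vertices of N[v_s] from v_s, and v_s itself (if new) from a
-- neighbour in V_T, grows a spanning tree all of whose edges have an end in S; ranks that
-- increase with the round in which a vertex is added make it acyclic.

open import Defs
open import Data.Nat using (ℕ; suc; _≤_; _<_; _+_; z≤n; s≤s; _<?_)
open import Data.Fin using (Fin; zero)
open import Data.Fin.Subset using (Subset; ⁅_⁆; ∣_∣; _∈_; _∉_; _∪_; _∩_; _⊂_; ⊤; inside; outside)
  renaming (⊥ to ∅)
open import Data.Product using (Σ; _×_; ∃; ∃₂; _,_; proj₁; proj₂; map₁; map₂; uncurry)

open import Data.Bool using (Bool; true; false; _∨_)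
open import Data.Bool.Properties using (∨-comm)
open import Data.Empty using (⊥; ⊥-elim)
open import Data.Fin as F using (toℕ)
import Data.Fin.Properties as F
open import Data.Fin.Subset.Properties
  using (_∈?_; ∈⊤; ⊆⊤; ⊆-antisym; p⊆p∪q; q⊆p∪q; x∈p∪q⁻; x∈p∩q⁺; x∈p∩q⁻;
         x∈⁅x⁆; x∈⁅y⁆⇒x≡y; ∣p∣≤∣x∷p∣; ∣⁅x⁆∣≡1; ∣⊥∣≡0; ∣p∩q∣≤∣p∣; p⊂q⇒∣p∣<∣q∣)
open import Data.List using (List; []; _∷_; last)
open import Data.List.Relation.Unary.All using (All; _∷_)
open import Data.List.Relation.Unary.AllPairs using (_∷_)
open import Data.List.Relation.Unary.Linked using (Linked; _∷_)
open import Data.List.Relation.Unary.Unique.Propositional using (Unique)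
open import Data.Maybe using (just)
open import Data.Maybe.Properties using (just-injective)
import Data.Nat.Properties as ℕ
open import Data.Sum using (_⊎_; inj₁; inj₂; [_,_]; swap) renaming (map to ⊎-map; map₂ to ⊎-map₂)
open import Data.Vec using ([]; _∷_; tabulate)
open import Data.Vec.Properties using (lookup∘tabulate; lookup⇒[]=; []=⇒lookup)
open import Function using (_∘_; id)
open import Relation.Binary.PropositionalEquality
  using (_≡_; _≢_; refl; cong; subst; subst₂; trans) renaming (sym to ≡-sym)
open import Relation.Nullary using (¬_; Dec; yes; no; ¬?)
open import Relation.Nullary.Decidable using (⌊_⌋; _×-dec_; decidable-stable)
open import Relation.Unary using (Decidable)

∨≡true⁻ : ∀ a {b} → a ∨ b ≡ true → a ≡ true ⊎ b ≡ true
∨≡true⁻ true  _ = inj₁ refl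
∨≡true⁻ false e = inj₂ e

∨≡true⁺ : ∀ a {b} → a ≡ true ⊎ b ≡ true → a ∨ b ≡ true
∨≡true⁺ true  _        = refl
∨≡true⁺ false (inj₁ ())
∨≡true⁺ false (inj₂ e) = e

⌊⌋≡true⁺ : ∀ {A : Set} (a? : Dec A) → A → ⌊ a? ⌋ ≡ true
⌊⌋≡true⁺ (yes _) _ = refl
⌊⌋≡true⁺ (no ¬a) a = ⊥-elim (¬a a)

⌊⌋≡true⁻ : ∀ {A : Set} (a? : Dec A) → ⌊ a? ⌋ ≡ true → A
⌊⌋≡true⁻ (yes a) _ = a

∈tabulate⁺ : ∀ {m} (f : Fin m → Bool) {i} → f i ≡ true → i ∈ tabulate f
∈tabulate⁺ f {i} e = lookup⇒[]= i (tabulate f) (trans (lookup∘tabulate f i) e)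

∈tabulate⁻ : ∀ {m} (f : Fin m → Bool) {i} → i ∈ tabulate f → f i ≡ true
∈tabulate⁻ f {i} i∈ = trans (≡-sym (lookup∘tabulate f i)) ([]=⇒lookup i∈)

∣p∪q∣≤∣p∣+∣q∣ : ∀ {m} (p q : Subset m) → ∣ p ∪ q ∣ ≤ ∣ p ∣ + ∣ q ∣
∣p∪q∣≤∣p∣+∣q∣ []            []            = z≤n
∣p∪q∣≤∣p∣+∣q∣ (inside ∷ p)  (x ∷ q)       =
  s≤s (ℕ.≤-trans (∣p∪q∣≤∣p∣+∣q∣ p q) (ℕ.+-monoʳ-≤ ∣ p ∣ (∣p∣≤∣x∷p∣ x q)))
∣p∪q∣≤∣p∣+∣q∣ (outside ∷ p) (inside ∷ q)  =
  ℕ.≤-trans (s≤s (∣p∪q∣≤∣p∣+∣q∣ p q)) (ℕ.≤-reflexive (≡-sym (ℕ.+-suc ∣ p ∣ ∣ q ∣)))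
∣p∪q∣≤∣p∣+∣q∣ (outside ∷ p) (outside ∷ q) = ∣p∪q∣≤∣p∣+∣q∣ p q

below : ∀ {m} → ℕ → Subset m
below k = tabulate (λ i → ⌊ toℕ i <? k ⌋)

∈below⁺ : ∀ {m k} {i : Fin m} → toℕ i < k → i ∈ below k
∈below⁺ {k = k} {i} = ∈tabulate⁺ _ ∘ ⌊⌋≡true⁺ (toℕ i <? k)

∈below⁻ : ∀ {m k} {i : Fin m} → i ∈ below k → toℕ i < k
∈below⁻ {k = k} {i} = ⌊⌋≡true⁻ (toℕ i <? k) ∘ ∈tabulate⁻ _

∩below⊂ : ∀ {m} {C : Subset m} {lo hi c} → lo ≤ hi → c ∈ C → lo ≤ toℕ c → toℕ c < hi →
          C ∩ below lo ⊂ C ∩ below hi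
∩below⊂ {C = C} {lo} {c = c} lo≤hi c∈C lo≤c c<hi = ⊆ , c , x∈p∩q⁺ (c∈C , ∈below⁺ c<hi) , c∉
  where
  ⊆ : ∀ {x} → x ∈ C ∩ below lo → x ∈ C ∩ below _
  ⊆ x∈ with x∈C , x<lo ← x∈p∩q⁻ C (below lo) x∈ =
    x∈p∩q⁺ (x∈C , ∈below⁺ (ℕ.<-≤-trans (∈below⁻ x<lo) lo≤hi))
  c∉ : c ∉ C ∩ below lo
  c∉ c∈ = ℕ.<⇒≱ (∈below⁻ (proj₂ (x∈p∩q⁻ C (below lo) c∈))) lo≤c

least? : ∀ {m} {P : Fin m → Set} → Decidable P → (∀ i → ¬ P i) ⊎ ∃ (IsLeast P)
least? {0}     P? = inj₁ λ ()
least? {suc m} P? with P? zero | least? (P? ∘ F.suc)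
... | yes p  | _                     = inj₂ (zero , p , λ _ _ → z≤n)
... | no ¬p  | inj₁ none             = inj₁ λ { zero → ¬p ; (F.suc i) → none i }
... | no ¬p  | inj₂ (i , pi , least) =
  inj₂ (F.suc i , pi , λ { zero p → ⊥-elim (¬p p) ; (F.suc j) pj → s≤s (least j pj) })

greatest? : ∀ {m} {P : Fin m → Set} → Decidable P → (∀ i → ¬ P i) ⊎ ∃ (IsGreatest P)
greatest? {0}     P? = inj₁ λ ()
greatest? {suc m} P? with greatest? (P? ∘ F.suc) | P? zero
... | inj₂ (i , pi , greatest) | _     =
  inj₂ (F.suc i , pi , λ { zero _ → z≤n ; (F.suc j) pj → s≤s (greatest j pj) })
... | inj₁ none                | yes p =
  inj₂ (zero , p , λ { zero _ → z≤n ; (F.suc j) pj → ⊥-elim (none j pj) })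
... | inj₁ none                | no ¬p = inj₁ λ { zero → ¬p ; (F.suc i) → none i }

greatest : ∀ {m} {P : Fin m → Set} → Decidable P → ∀ {i} → P i → ∃ (IsGreatest P)
greatest P? {i} pi with greatest? P?
... | inj₁ none = ⊥-elim (none i pi)
... | inj₂ max  = max

min₂ : ∀ {m} (t₁ t₂ : Fin m) → ∃ (IsMin₂ t₁ t₂)
min₂ t₁ t₂ with t₁ F.≤? t₂
... | yes t₁≤t₂ = t₁ , inj₁ (t₁≤t₂ , refl)
... | no  t₁≰t₂ = t₂ , inj₂ (ℕ.≰⇒> t₁≰t₂ , refl)

module _ {m} (G : Graph m) where

  Edge-sym : ∀ {u v} → Edge G u v → Edge G v u
  Edge-sym {u} {v} e = trans (sym G v u) e

  reach-snoc : ∀ {u v w} → Reach G u v → Edge G v w → Reach G u w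
  reach-snoc here       e = step e here
  reach-snoc (step d r) e = step d (reach-snoc r e)

  reach-sym : ∀ {u v} → Reach G u v → Reach G v u
  reach-sym here       = here
  reach-sym (step e r) = reach-snoc (reach-sym r) (Edge-sym e)

  reach-trans : ∀ {u v w} → Reach G u v → Reach G v w → Reach G u w
  reach-trans here       r′ = r′
  reach-trans (step e r) r′ = step e (reach-trans r r′)

  first-edge : ∀ {u w} → Reach G u w → u ≢ w → ∃ (Edge G u)
  first-edge here               u≢w = ⊥-elim (u≢w refl)
  first-edge (step {v = v} e _) _   = v , e

  leaving-edge : ∀ (X : Subset m) {u w} → Reach G u w → u ∈ X → w ∉ X →
                 ∃₂ λ a c → a ∈ X × c ∉ X × Edge G a c
  leaving-edge X here u∈X w∉X = ⊥-elim (w∉X u∈X)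
  leaving-edge X {u} (step {v = v} e r) u∈X w∉X with v ∈? X
  ... | yes v∈X = leaving-edge X r v∈X w∉X
  ... | no  v∉X = u , v , u∈X , v∉X , e

  ∈N[]⁺ : ∀ {v u} → Edge G v u ⊎ u ≡ v → u ∈ N[ G ] v
  ∈N[]⁺ {v} {u} h = ∈tabulate⁺ _ (∨≡true⁺ (adj G v u) (⊎-map₂ (⌊⌋≡true⁺ (u F.≟ v)) h))

  ∈N[]⁻ : ∀ {v u} → u ∈ N[ G ] v → Edge G v u ⊎ u ≡ v
  ∈N[]⁻ {v} {u} u∈ = ⊎-map₂ (⌊⌋≡true⁻ (u F.≟ v)) (∨≡true⁻ (adj G v u) (∈tabulate⁻ _ u∈))

  v∈N[v] : ∀ v → v ∈ N[ G ] v
  v∈N[v] v = ∈N[]⁺ (inj₂ refl)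

  Edge⇒∈N[] : ∀ {v u} → Edge G v u → u ∈ N[ G ] v
  Edge⇒∈N[] = ∈N[]⁺ ∘ inj₁

  ∈N[]⇒Edge : ∀ {v u} → u ∈ N[ G ] v → u ≢ v → Edge G v u
  ∈N[]⇒Edge u∈ u≢v with ∈N[]⁻ u∈
  ... | inj₁ e   = e
  ... | inj₂ u≡v = ⊥-elim (u≢v u≡v)

  ∈N[]-sym : ∀ {v u} → u ∈ N[ G ] v → v ∈ N[ G ] u
  ∈N[]-sym u∈ with ∈N[]⁻ u∈
  ... | inj₁ e    = Edge⇒∈N[] (Edge-sym e)
  ... | inj₂ refl = u∈

lastOf : ∀ {A : Set} → A → List A → A
lastOf a []      = a
lastOf _ (b ∷ r) = lastOf b r

penultimateOf : ∀ {A : Set} → A → A → List A → A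
penultimateOf a _ []      = a
penultimateOf _ b (c ∷ r) = penultimateOf b c r

last≡lastOf : ∀ {A : Set} (a : A) r → last (a ∷ r) ≡ just (lastOf a r)
last≡lastOf a []      = refl
last≡lastOf _ (b ∷ r) = last≡lastOf b r

All-lastOf : ∀ {A : Set} {P : A → Set} a r → All P (a ∷ r) → P (lastOf a r)
All-lastOf a []      (pa ∷ _)  = pa
All-lastOf _ (b ∷ r) (_ ∷ pbr) = All-lastOf b r pbr

All-penultimateOf : ∀ {A : Set} {P : A → Set} a b r → All P (a ∷ b ∷ r) → P (penultimateOf a b r)
All-penultimateOf a _ []      (pa ∷ _)   = pa
All-penultimateOf _ b (c ∷ r) (_ ∷ pbcr) = All-penultimateOf b c r pbcr

Linked-end : ∀ {A : Set} {R : A → A → Set} a b r →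
             Linked R (a ∷ b ∷ r) → R (penultimateOf a b r) (lastOf b r)
Linked-end _ _ []      (Rab ∷ _)  = Rab
Linked-end _ b (c ∷ r) (_ ∷ Rbcr) = Linked-end b c r Rbcr

-- If every vertex has at most one lower neighbour, a path without repeated vertices
-- that once goes up keeps going up; so on a cycle the higher end of the closing
-- edge would have two distinct lower neighbours.
module RankedAcyclic {m} (H : Graph m) (rank : Fin m → ℕ)
  (rank-≢ : ∀ {u v} → Edge H u v → rank u < rank v ⊎ rank v < rank u)
  (lower-unique : ∀ {a b c} → Edge H a b → Edge H c b → rank a < rank b → rank c < rank b → a ≡ c)
  where

  rises : ∀ a b r → Linked (Edge H) (a ∷ b ∷ r) → Unique (a ∷ b ∷ r) → rank a < rank b →
          rank a < rank (lastOf b r) × rank (penultimateOf a b r) < rank (lastOf b r)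
  rises a b []      _              _                         a<b = a<b , a<b
  rises a b (c ∷ r) (a~b ∷ b~c∷r@(b~c ∷ _)) ((_ ∷ a≢c ∷ _) ∷ U) a<b with rank-≢ b~c
  ... | inj₂ c<b = ⊥-elim (a≢c (lower-unique a~b (Edge-sym H b~c) a<b c<b))
  ... | inj₁ b<c = map₁ (ℕ.<-trans a<b) (rises b c r b~c∷r U b<c)

  falls : ∀ a b r → Linked (Edge H) (a ∷ b ∷ r) → Unique (a ∷ b ∷ r) →
          rank (lastOf b r) < rank (penultimateOf a b r) → rank (lastOf b r) < rank a
  falls a b []      _               _       z<p = z<p
  falls a b (c ∷ r) L@(a~b ∷ b~c∷r) U@(_ ∷ U′) z<p with rank-≢ a~b
  ... | inj₁ a<b = ⊥-elim (ℕ.<-asym z<p (proj₂ (rises a b (c ∷ r) L U a<b)))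
  ... | inj₂ b<a = ℕ.<-trans (falls b c r b~c∷r U′ z<p) b<a

  ranked⇒acyclic : Acyclic H
  ranked⇒acyclic []                ()
  ranked⇒acyclic (_ ∷ [])          (s≤s () , _)
  ranked⇒acyclic (_ ∷ _ ∷ [])      (s≤s (s≤s ()) , _)
  ranked⇒acyclic (x ∷ x₁ ∷ c ∷ r) (_ , U@(x≢rest ∷ x₁≢rest ∷ _) , L@(x~x₁ ∷ _) , z , last≡z , z~x)
    with refl ← just-injective (trans (≡-sym last≡z) (last≡lastOf x (x₁ ∷ c ∷ r)))
    with rank-≢ z~x
  ... | inj₁ z<x = x-is-no-peak
    where
    x-is-no-peak : ⊥
    x-is-no-peak with rank-≢ x~x₁
    ... | inj₁ x<x₁ = ℕ.<-asym z<x (proj₁ (rises x x₁ (c ∷ r) L U x<x₁))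
    ... | inj₂ x₁<x = All-lastOf c r x₁≢rest (lower-unique (Edge-sym H x~x₁) z~x x₁<x z<x)
  ... | inj₂ x<z = z-is-no-peak
    where
    z-is-no-peak : ⊥
    z-is-no-peak with rank-≢ (Linked-end x x₁ (c ∷ r) L)
    ... | inj₁ p<z = All-penultimateOf x₁ c r x≢rest
                       (≡-sym (lower-unique (Linked-end x x₁ (c ∷ r) L) (Edge-sym H z~x) p<z x<z))
    ... | inj₂ z<p = ℕ.<-asym x<z (falls x x₁ (c ∷ r) L U z<p)

record ParentLink {m} (G : Graph m) (S : Subset m) (rank : Fin m → ℕ) (v p : Fin m) : Set where
  field
    rank<  : rank p < rank v
    edge   : Edge G v p
    covers : v ∈ S ⊎ p ∈ S

module ParentTree {n} (parent : Fin (suc n) → Fin (suc n)) (rank : Fin (suc n) → ℕ)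
  (rank-parent : ∀ v → v ≢ zero → rank (parent v) < rank v) where

  ChildOf : Fin (suc n) → Fin (suc n) → Set
  ChildOf u v = u ≢ zero × parent u ≡ v

  childOf? : ∀ u v → Dec (ChildOf u v)
  childOf? u v = ¬? (u F.≟ zero) ×-dec (parent u F.≟ v)

  ¬ChildOf-self : ∀ v → ¬ ChildOf v v
  ¬ChildOf-self v (v≢0 , parent≡v) = ℕ.<-irrefl (cong rank parent≡v) (rank-parent v v≢0)

  tree : Graph (suc n)
  tree = record
    { adj    = λ u v → ⌊ childOf? u v ⌋ ∨ ⌊ childOf? v u ⌋
    ; sym    = λ u v → ∨-comm ⌊ childOf? u v ⌋ ⌊ childOf? v u ⌋
    ; irrefl = irrefl′
    }
    where
    irrefl′ : ∀ v → ⌊ childOf? v v ⌋ ∨ ⌊ childOf? v v ⌋ ≡ false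
    irrefl′ v with childOf? v v
    ... | yes c = ⊥-elim (¬ChildOf-self v c)
    ... | no _  = refl

  tree-edge⁻ : ∀ {u v} → Edge tree u v → ChildOf u v ⊎ ChildOf v u
  tree-edge⁻ {u} {v} e = ⊎-map (⌊⌋≡true⁻ (childOf? u v)) (⌊⌋≡true⁻ (childOf? v u)) (∨≡true⁻ _ e)

  parent-edge : ∀ v → v ≢ zero → Edge tree v (parent v)
  parent-edge v v≢0 = ∨≡true⁺ _ (inj₁ (⌊⌋≡true⁺ (childOf? v (parent v)) (v≢0 , refl)))

  reach-root : ∀ k v → rank v < k → Reach tree v zero
  reach-root (suc k) v v<k with v F.≟ zero
  ... | yes refl = here
  ... | no v≢0   = step (parent-edge v v≢0)
                     (reach-root k (parent v) (ℕ.<-≤-trans (rank-parent v v≢0) (ℕ.≤-pred v<k)))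

  tree-connected : Connected tree
  tree-connected u v =
    reach-trans tree (reach-root _ u (ℕ.n<1+n _)) (reach-sym tree (reach-root _ v (ℕ.n<1+n _)))

  rank-≢ : ∀ {u v} → Edge tree u v → rank u < rank v ⊎ rank v < rank u
  rank-≢ {u} {v} e with tree-edge⁻ {u} {v} e
  ... | inj₁ (u≢0 , refl) = inj₂ (rank-parent _ u≢0)
  ... | inj₂ (v≢0 , refl) = inj₁ (rank-parent _ v≢0)

  lower⇒parent : ∀ {a b} → Edge tree a b → rank a < rank b → parent b ≡ a
  lower⇒parent {a} {b} e a<b with tree-edge⁻ {a} {b} e
  ... | inj₁ (a≢0 , refl) = ⊥-elim (ℕ.<-asym a<b (rank-parent _ a≢0))
  ... | inj₂ (_ , b↦a)    = b↦a

  tree-acyclic : Acyclic tree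
  tree-acyclic = RankedAcyclic.ranked⇒acyclic tree rank rank-≢
    (λ a~b c~b a<b c<b → trans (≡-sym (lower⇒parent a~b a<b)) (lower⇒parent c~b c<b))

parentTree : ∀ {n} (G : Graph (suc n)) (S : Subset (suc n))
             (parent : Fin (suc n) → Fin (suc n)) (rank : Fin (suc n) → ℕ) →
             (∀ v → v ≢ zero → ParentLink G S rank v (parent v)) →
             Σ (Graph (suc n)) (λ T → IsSpanningTree G T × IsVertexCover T S)
parentTree G S parent rank link = tree , (tree⊆G , tree-connected , tree-acyclic) , covered
  where
  open ParentTree parent rank (λ v v≢0 → ParentLink.rank< (link v v≢0))

  tree⊆G : ∀ u v → Edge tree u v → Edge G u v
  tree⊆G u v e with tree-edge⁻ {u} {v} e
  ... | inj₁ (u≢0 , refl) = ParentLink.edge (link u u≢0)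
  ... | inj₂ (v≢0 , refl) = Edge-sym G (ParentLink.edge (link v v≢0))

  covered : IsVertexCover tree S
  covered u v e with tree-edge⁻ {u} {v} e
  ... | inj₁ (u≢0 , refl) = ParentLink.covers (link u u≢0)
  ... | inj₂ (v≢0 , refl) = swap (ParentLink.covers (link v v≢0))

module Algorithm {n} (G : Graph (suc n)) (connected : Connected G) (interval : IsIntervalOrdering G)
  where

  ∈N[]-convex : ∀ {a b c} → a F.≤ b → b F.≤ c → a ∈ N[ G ] c → b ∈ N[ G ] c
  ∈N[]-convex {a} {b} {c} a≤b b≤c a∈N[c] with b F.≟ c | a F.≟ b
  ... | yes refl | _        = v∈N[v] G b
  ... | no _     | yes refl = a∈N[c]
  ... | no b≢c   | no a≢b   = Edge⇒∈N[] G (Edge-sym G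
        (interval a b c (F.≤∧≢⇒< a≤b a≢b) (F.≤∧≢⇒< b≤c b≢c) (Edge-sym G (∈N[]⇒Edge G a∈N[c] a≢c))))
    where
    a≢c : a ≢ c
    a≢c refl = a≢b (F.≤-antisym a≤b b≤c)

  ∈N[]-across : ∀ {a t c} → a F.≤ t → t F.< c → Edge G a c → c ∈ N[ G ] t
  ∈N[]-across a≤t t<c a~c =
    ∈N[]-sym G (∈N[]-convex a≤t (ℕ.<⇒≤ t<c) (∈N[]-sym G (Edge⇒∈N[] G a~c)))

  record Explored (VT : Subset (suc n)) (lo : ℕ) : Set where
    field
      zero∈   : zero ∈ VT
      N[<lo]⊆ : ∀ {x y} → toℕ x < lo → y ∈ N[ G ] x → y ∈ VT
      ⊆N[<lo] : ∀ {y} → y ∈ VT → y ≡ zero ⊎ ∃ λ x → toℕ x < lo × y ∈ N[ G ] x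

    ∉⇒lo≤ : ∀ {x} → x ∉ VT → lo ≤ toℕ x
    ∉⇒lo≤ {x} x∉ = ℕ.≮⇒≥ λ x<lo → x∉ (N[<lo]⊆ x<lo (v∈N[v] G x))

    edge-out⇒lo≤ : ∀ {a c} → Edge G a c → c ∉ VT → lo ≤ toℕ a
    edge-out⇒lo≤ a~c c∉ = ℕ.≮⇒≥ λ a<lo → c∉ (N[<lo]⊆ a<lo (Edge⇒∈N[] G a~c))

    ∈-above⇒edge : ∀ {y} → y ∈ VT → lo ≤ toℕ y → y ≡ zero ⊎ ∃ λ x → toℕ x < lo × Edge G x y
    ∈-above⇒edge y∈ lo≤y with ⊆N[<lo] y∈
    ... | inj₁ y≡0                  = inj₁ y≡0
    ... | inj₂ (x , x<lo , y∈N[x]) =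
      inj₂ (x , x<lo , ∈N[]⇒Edge G y∈N[x] λ { refl → ℕ.<⇒≱ x<lo lo≤y })

  explored₀ : Explored ⁅ zero ⁆ 0
  explored₀ = record
    { zero∈   = x∈⁅x⁆ zero
    ; N[<lo]⊆ = λ ()
    ; ⊆N[<lo] = λ y∈ → inj₁ (x∈⁅y⁆⇒x≡y zero y∈)
    }

  module Step {VT lo} (explored : Explored VT lo) {t₁ t₂ t s : Fin (suc n)}
    (t₁-least : IsLeast (_∉ VT) t₁) (t₂-greatest : IsGreatest (_∈ VT) t₂)
    (t-min : IsMin₂ t₁ t₂ t) (s-greatest : IsGreatest (_∈ N[ G ] t) s) where
    open Explored explored

    t₁∉ : t₁ ∉ VT
    t₁∉ = proj₁ t₁-least

    t₂∈ : t₂ ∈ VT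
    t₂∈ = proj₁ t₂-greatest

    N[t]≤s : ∀ {u} → u ∈ N[ G ] t → u F.≤ s
    N[t]≤s = proj₂ s-greatest _

    t≤s : t F.≤ s
    t≤s = N[t]≤s (v∈N[v] G t)

    t≤t₁ : t F.≤ t₁
    t≤t₁ = [ F.≤-reflexive ∘ proj₂ , (λ { (t₂<t₁ , refl) → ℕ.<⇒≤ t₂<t₁ }) ] t-min

    t₁<t₂ : t₁ F.≤ t₂ → t₁ F.< t₂
    t₁<t₂ t₁≤t₂ = F.≤∧≢⇒< t₁≤t₂ λ { refl → t₁∉ t₂∈ }

    t₂∈N[t₁] : t₁ F.≤ t₂ → t₂ ∈ N[ G ] t₁
    t₂∈N[t₁] t₁≤t₂ with ∈-above⇒edge t₂∈ (ℕ.≤-trans (∉⇒lo≤ t₁∉) t₁≤t₂)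
    ... | inj₁ refl                = ⊥-elim (ℕ.n≮0 (t₁<t₂ t₁≤t₂))
    ... | inj₂ (x , x<lo , x~t₂) =
      ∈N[]-across (ℕ.<⇒≤ (ℕ.<-≤-trans x<lo (∉⇒lo≤ t₁∉))) (t₁<t₂ t₁≤t₂) x~t₂

    attached-via-t₂ : t₁ F.≤ t₂ → t ≡ t₁ → ∃ λ q → q ∈ VT × s ∈ N[ G ] q
    attached-via-t₂ t₁≤t₂ refl = t₂ , t₂∈ , ∈N[]-sym G
      (∈N[]-convex t₁≤t₂ (N[t]≤s (t₂∈N[t₁] t₁≤t₂)) (∈N[]-sym G (proj₁ s-greatest)))

    attached : ∃ λ q → q ∈ VT × s ∈ N[ G ] q
    attached = [ uncurry attached-via-t₂ , (λ { (_ , refl) → t₂ , t₂∈ , proj₁ s-greatest }) ] t-min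

    BoundaryEdge : Graph (suc n) → Set
    BoundaryEdge H = ∃₂ λ a c → Edge H a c × c ∉ VT × a F.≤ s × t₁ F.≤ c × c F.≤ s

    module _ {H : Graph (suc n)} (H⊆G : ∀ u v → Edge H u v → Edge G u v) (H-connected : Connected H)
      where

      edge-at-t₁ : t ≡ t₁ → BoundaryEdge H
      edge-at-t₁ refl with first-edge H (H-connected t₁ zero) (λ { refl → t₁∉ zero∈ })
      ... | w , t₁~w =
        w , t₁ , Edge-sym H t₁~w , t₁∉ , N[t]≤s (Edge⇒∈N[] G (H⊆G _ _ t₁~w)) , F.≤-refl , t≤s

      edge-into-N[t] : t₂ F.< t₁ → t ≡ t₂ → BoundaryEdge H
      edge-into-N[t] t₂<t₁ refl with leaving-edge H VT (H-connected zero t₁) zero∈ t₁∉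
      ... | a , c , a∈ , c∉ , a~c =
        a , c , a~c , c∉ , ℕ.≤-trans a≤t t≤s , t₁≤c ,
        N[t]≤s (∈N[]-across a≤t (ℕ.<-≤-trans t₂<t₁ t₁≤c) (H⊆G _ _ a~c))
        where
        a≤t = proj₂ t₂-greatest a a∈
        t₁≤c = proj₂ t₁-least c c∉

      boundary-edge : BoundaryEdge H
      boundary-edge = [ edge-at-t₁ ∘ proj₂ , uncurry edge-into-N[t] ] t-min

    lo≤s : lo ≤ toℕ s
    lo≤s with _ , c , _ , _ , _ , t₁≤c , c≤s ← boundary-edge (λ _ _ e → e) connected =
      ℕ.≤-trans (∉⇒lo≤ t₁∉) (ℕ.≤-trans t₁≤c c≤s)

    VT≢⊤ : VT ≢ ⊤
    VT≢⊤ VT≡⊤ = t₁∉ (subst (t₁ ∈_) (≡-sym VT≡⊤) ∈⊤)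

    cover-hit : ∀ {T C} → IsSpanningTree G T → IsVertexCover T C →
                ∃ λ c → c ∈ C × lo ≤ toℕ c × c F.≤ s
    cover-hit (T⊆G , T-connected , _) cover
      with a , c , a~c , c∉ , a≤s , _ , c≤s ← boundary-edge T⊆G T-connected
      with cover a c a~c
    ... | inj₁ a∈C = a , a∈C , edge-out⇒lo≤ (T⊆G a c a~c) c∉ , a≤s
    ... | inj₂ c∈C = c , c∈C , ∉⇒lo≤ c∉ , c≤s

    count-step : ∀ {S T C} → IsSpanningTree G T → IsVertexCover T C →
                 ∣ S ∣ ≤ ∣ C ∩ below lo ∣ → ∣ S ∪ ⁅ s ⁆ ∣ ≤ ∣ C ∩ below (suc (toℕ s)) ∣
    count-step {S} {C = C} spanning cover S≤ with c , c∈C , lo≤c , c≤s ← cover-hit spanning cover =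
      begin
        ∣ S ∪ ⁅ s ⁆ ∣                ≤⟨ ∣p∪q∣≤∣p∣+∣q∣ S ⁅ s ⁆ ⟩
        ∣ S ∣ + ∣ ⁅ s ⁆ ∣            ≡⟨ cong (∣ S ∣ +_) (∣⁅x⁆∣≡1 s) ⟩
        ∣ S ∣ + 1                    ≡⟨ ℕ.+-comm ∣ S ∣ 1 ⟩
        suc ∣ S ∣                    ≤⟨ s≤s S≤ ⟩
        suc ∣ C ∩ below lo ∣         ≤⟨ p⊂q⇒∣p∣<∣q∣ (∩below⊂ (ℕ.m≤n⇒m≤1+n lo≤s) c∈C lo≤c (s≤s c≤s)) ⟩
        ∣ C ∩ below (suc (toℕ s)) ∣  ∎
      where open ℕ.≤-Reasoning

    ≤s⇒∈ : ∀ {y} → y F.≤ s → y ∈ VT ∪ N[ G ] s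
    ≤s⇒∈ {y} y≤s with y F.<? t₁
    ... | yes y<t₁ = p⊆p∪q _ (decidable-stable (y ∈? VT) λ y∉ → ℕ.<⇒≱ y<t₁ (proj₂ t₁-least y y∉))
    ... | no  y≮t₁ = q⊆p∪q VT _
          (∈N[]-convex (ℕ.≤-trans t≤t₁ (ℕ.≮⇒≥ y≮t₁)) y≤s (∈N[]-sym G (proj₁ s-greatest)))

    N[≤s]⊆ : ∀ {x y} → x F.≤ s → y ∈ N[ G ] x → y ∈ VT ∪ N[ G ] s
    N[≤s]⊆ {x} {y} x≤s y∈N[x] with y F.≤? s
    ... | yes y≤s = ≤s⇒∈ y≤s
    ... | no  y≰s =
      q⊆p∪q VT _ (∈N[]-across x≤s (ℕ.≰⇒> y≰s) (∈N[]⇒Edge G y∈N[x] λ { refl → y≰s x≤s }))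

    explored′ : Explored (VT ∪ N[ G ] s) (suc (toℕ s))
    explored′ = record
      { zero∈   = p⊆p∪q _ zero∈
      ; N[<lo]⊆ = λ x<1+s → N[≤s]⊆ (ℕ.≤-pred x<1+s)
      ; ⊆N[<lo] = ⊆N[≤s]
      }
      where
      ⊆N[≤s] : ∀ {y} → y ∈ VT ∪ N[ G ] s → y ≡ zero ⊎ ∃ λ x → toℕ x < suc (toℕ s) × y ∈ N[ G ] x
      ⊆N[≤s] y∈ with x∈p∪q⁻ VT _ y∈
      ... | inj₂ y∈N[s] = inj₂ (s , ℕ.n<1+n _ , y∈N[s])
      ... | inj₁ y∈VT   =
        ⊎-map₂ (λ { (x , x<lo , y∈N[x]) → x , ℕ.<-≤-trans x<lo (ℕ.m≤n⇒m≤1+n lo≤s) , y∈N[x] })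
               (⊆N[<lo] y∈VT)

  runs-exist : ∀ fuel {S VT lo} → suc n ≤ fuel + lo → Explored VT lo → ∃ (Runs G S VT)
  runs-exist fuel {S} {VT} {lo} enough explored with least? (λ i → ¬? (i ∈? VT))
  ... | inj₁ none∉ = S , done (⊆-antisym ⊆⊤ λ {i} _ → decidable-stable (i ∈? VT) (none∉ i))
  ... | inj₂ (t₁ , t₁-least) = continue fuel enough
    where
    t₂ = greatest (_∈? VT) (Explored.zero∈ explored)
    t  = min₂ t₁ (proj₁ t₂)
    s  = greatest (_∈? N[ G ] (proj₁ t)) (v∈N[v] G (proj₁ t))
    open Step explored t₁-least (proj₂ t₂) (proj₂ t) (proj₂ s)

    continue : ∀ fuel → suc n ≤ fuel + lo → ∃ (Runs G S VT)
    continue 0 enough =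
      ⊥-elim (ℕ.<-irrefl refl (ℕ.<-≤-trans (F.toℕ<n (proj₁ s)) (ℕ.≤-trans enough lo≤s)))
    continue (suc fuel) enough =
      map₂ (loop t₁ (proj₁ t₂) (proj₁ t) (proj₁ s) VT≢⊤ t₁-least (proj₂ t₂) (proj₂ t) (proj₂ s))
           (runs-exist fuel enough′ explored′)
      where
      enough′ : suc n ≤ fuel + suc (toℕ (proj₁ s))
      enough′ = ℕ.≤-trans enough (ℕ.≤-trans (ℕ.≤-reflexive (≡-sym (ℕ.+-suc fuel lo)))
                                            (ℕ.+-monoʳ-≤ fuel (s≤s lo≤s)))

  record Forest (S VT : Subset (suc n)) : Set where
    field
      parent     : Fin (suc n) → Fin (suc n)
      rank       : Fin (suc n) → ℕ
      bound      : ℕ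
      rank<bound : ∀ {v} → v ∈ VT → rank v < bound
      parent∈    : ∀ {v} → v ∈ VT → v ≢ zero → parent v ∈ VT
      link       : ∀ {v} → v ∈ VT → v ≢ zero → ParentLink G S rank v (parent v)

  forest₀ : Forest ∅ ⁅ zero ⁆
  forest₀ = record
    { parent     = λ v → v
    ; rank       = λ _ → 0
    ; bound      = 1
    ; rank<bound = λ _ → s≤s z≤n
    ; parent∈    = λ v∈ v≢0 → ⊥-elim (v≢0 (x∈⁅y⁆⇒x≡y zero v∈))
    ; link       = λ v∈ v≢0 → ⊥-elim (v≢0 (x∈⁅y⁆⇒x≡y zero v∈))
    }

  extend : ∀ {S VT s} → (∃ λ q → q ∈ VT × s ∈ N[ G ] q) →
           Forest S VT → Forest (S ∪ ⁅ s ⁆) (VT ∪ N[ G ] s)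
  extend {S} {VT} {s} (q , q∈VT , s∈N[q]) F = record
    { parent     = parent′
    ; rank       = rank′
    ; bound      = suc (suc bound)
    ; rank<bound = rank′<bound
    ; parent∈    = λ v∈ v≢0 → proj₁ (link′ v∈ v≢0)
    ; link       = λ v∈ v≢0 → proj₂ (link′ v∈ v≢0)
    }
    where
    open Forest F

    parent′ : Fin (suc n) → Fin (suc n)
    parent′ v with v ∈? VT | v F.≟ s
    ... | yes _ | _     = parent v
    ... | no _  | yes _ = q
    ... | no _  | no _  = s

    rank′ : Fin (suc n) → ℕ
    rank′ v with v ∈? VT | v F.≟ s
    ... | yes _ | _     = rank v
    ... | no _  | yes _ = bound
    ... | no _  | no _  = suc bound

    rank′-old : ∀ {v} → v ∈ VT → rank′ v ≡ rank v
    rank′-old {v} v∈ with v ∈? VT | v F.≟ s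
    ... | yes _ | _  = refl
    ... | no v∉ | _  = ⊥-elim (v∉ v∈)

    rank′-root : s ∉ VT → rank′ s ≡ bound
    rank′-root s∉ with s ∈? VT | s F.≟ s
    ... | yes s∈ | _      = ⊥-elim (s∉ s∈)
    ... | no _   | yes _  = refl
    ... | no _   | no s≢s = ⊥-elim (s≢s refl)

    rank′-leaf : ∀ {v} → v ∉ VT → v ≢ s → rank′ v ≡ suc bound
    rank′-leaf {v} v∉ v≢s with v ∈? VT | v F.≟ s
    ... | yes v∈ | _        = ⊥-elim (v∉ v∈)
    ... | no _   | yes v≡s  = ⊥-elim (v≢s v≡s)
    ... | no _   | no _     = refl

    rank′s≤bound : rank′ s ≤ bound
    rank′s≤bound with s ∈? VT | s F.≟ s
    ... | yes s∈ | _      = ℕ.<⇒≤ (rank<bound s∈)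
    ... | no _   | yes _  = ℕ.≤-refl
    ... | no _   | no s≢s = ⊥-elim (s≢s refl)

    rank′<bound : ∀ {v} → v ∈ VT ∪ N[ G ] s → rank′ v < suc (suc bound)
    rank′<bound {v} _ with v ∈? VT | v F.≟ s
    ... | yes v∈ | _     = ℕ.<-trans (rank<bound v∈) (ℕ.<-trans (ℕ.n<1+n _) (ℕ.n<1+n _))
    ... | no _   | yes _ = ℕ.<-trans (ℕ.n<1+n _) (ℕ.n<1+n _)
    ... | no _   | no _  = ℕ.n<1+n _

    s∈S′ : s ∈ S ∪ ⁅ s ⁆
    s∈S′ = q⊆p∪q S _ (x∈⁅x⁆ s)

    link′ : ∀ {v} → v ∈ VT ∪ N[ G ] s → v ≢ zero →
            parent′ v ∈ VT ∪ N[ G ] s × ParentLink G (S ∪ ⁅ s ⁆) rank′ v (parent′ v)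
    link′ {v} v∈ v≢0 with v ∈? VT | v F.≟ s
    ... | yes v∈VT | _ = p⊆p∪q _ (parent∈ v∈VT v≢0) , record
      { rank<  = subst₂ _<_ (≡-sym (rank′-old (parent∈ v∈VT v≢0))) (≡-sym (rank′-old v∈VT))
                        (ParentLink.rank< old)
      ; edge   = ParentLink.edge old
      ; covers = ⊎-map (p⊆p∪q _) (p⊆p∪q _) (ParentLink.covers old)
      }
      where old = link v∈VT v≢0
    ... | no s∉VT | yes refl = p⊆p∪q _ q∈VT , record
      { rank<  = subst₂ _<_ (≡-sym (rank′-old q∈VT)) (≡-sym (rank′-root s∉VT)) (rank<bound q∈VT)
      ; edge   = Edge-sym G (∈N[]⇒Edge G s∈N[q] λ { refl → s∉VT q∈VT })
      ; covers = inj₁ s∈S′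
      }
    ... | no v∉VT | no v≢s = q⊆p∪q VT _ (v∈N[v] G s) , record
      { rank<  = subst (rank′ s <_) (≡-sym (rank′-leaf v∉VT v≢s)) (s≤s rank′s≤bound)
      ; edge   = Edge-sym G (∈N[]⇒Edge G v∈N[s] v≢s)
      ; covers = inj₂ s∈S′
      }
      where v∈N[s] = [ ⊥-elim ∘ v∉VT , id ] (x∈p∪q⁻ VT _ v∈)

  upper-bound : ∀ {S VT lo R} → Runs G S VT R → Explored VT lo → Forest S VT →
                Σ (Graph (suc n)) (λ T → IsSpanningTree G T × IsVertexCover T R)
  upper-bound {S} (done refl) _ F = parentTree G S parent rank (λ v v≢0 → link ∈⊤ v≢0)
    where open Forest F
  upper-bound (loop _ _ _ _ _ t₁-least t₂-greatest t-min s-greatest runs) explored F =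
    upper-bound runs explored′ (extend attached F)
    where open Step explored t₁-least t₂-greatest t-min s-greatest

  lower-bound : ∀ {S VT lo R T C} → Runs G S VT R → Explored VT lo →
                IsSpanningTree G T → IsVertexCover T C → ∣ S ∣ ≤ ∣ C ∩ below lo ∣ → ∣ R ∣ ≤ ∣ C ∣
  lower-bound {C = C} (done _) _ _ _ S≤ = ℕ.≤-trans S≤ (∣p∩q∣≤∣p∣ C _)
  lower-bound {S} (loop _ _ _ _ _ t₁-least t₂-greatest t-min s-greatest runs)
              explored spanning cover S≤ =
    lower-bound runs explored′ spanning cover (count-step {S} spanning cover S≤)
    where open Step explored t₁-least t₂-greatest t-min s-greatest

lemma7 : ∀ (n : ℕ) (G : Graph (suc n)) → Connected G → IsIntervalOrdering G →
    Σ (Subset (suc n)) (λ S → Runs G ∅ ⁅ zero ⁆ S)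
    × (∀ (S : Subset (suc n)) → Runs G ∅ ⁅ zero ⁆ S →
        Σ (Graph (suc n)) (λ T → IsSpanningTree G T × IsVertexCover T S)
        × (∀ (T : Graph (suc n)) (C : Subset (suc n)) →
             IsSpanningTree G T → IsVertexCover T C → ∣ S ∣ ≤ ∣ C ∣))
lemma7 n G connected interval =
    runs-exist (suc n) (ℕ.m≤m+n (suc n) 0) explored₀
  , λ S runs → upper-bound runs explored₀ forest₀
             , λ T C spanning cover → lower-bound runs explored₀ spanning cover ∣∅∣≤
  where
  open Algorithm G connected interval
  ∣∅∣≤ : ∀ {k} → ∣ ∅ {suc n} ∣ ≤ k
  ∣∅∣≤ = ℕ.≤-trans (ℕ.≤-reflexive (∣⊥∣≡0 (suc n))) z≤n
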